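{- Let $G$ be the complement of a cycle of length at least five. Then $G$ is an induced-minor-minimal non-$2$-cograph.
   Context: All graphs are finite and simple; $\overline{G}$ denotes the complement of $G$. A graph is $2$-connected if it has at least three vertices, is connected, and has no cut vertex. A graph $G$ is a $2$-cograph if $G$ has no induced subgraph $H$ such that both $H$ and $\overline{H}$ are $2$-connected. For an edge $e$, $G/e$ is the simple graph obtained by contracting $e$ and removing parallel edges. An induced minor of $G$ is a graph obtained from $G$ by a sequence of vertex deletions and edge contractions; it is proper if at least one such operation is performed. An induced-minor-minimal non-$2$-cograph is a graph that is not a $2$-cograph but all of whose proper induced minors are $2$-cographs. -}

module Defs where

open import Data.Nat using (ℕ; zero; suc; _≤_; _∸_)
import Data.Nat as ℕ
open import Data.Fin using (Fin; toℕ; punchIn)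
open import Data.Fin.Properties using (_≟_)
open import Data.Bool using (Bool; true; false; not; _∧_; _∨_)
open import Data.Bool.Properties using (∨-comm)
open import Data.Product using (Σ; ∃; ∃-syntax; _×_; _,_)
open import Function.Bundles using (_↣_; Injection)
open import Relation.Nullary using (¬_; Dec; yes; no)
open import Relation.Nullary.Decidable using (⌊_⌋)
open import Relation.Binary.PropositionalEquality using (_≡_; _≢_; refl; sym; cong; cong₂)

record Graph : Set where
  field
    n      : ℕ
    adj    : Fin n → Fin n → Bool
    adj-sym : ∀ i j → adj i j ≡ adj j i
    irrefl : ∀ i → adj i i ≡ false

open Graph public

_==_ : ∀ {n} → Fin n → Fin n → Bool
i == j = ⌊ i ≟ j ⌋

==-sym : ∀ {n} (i j : Fin n) → (i == j) ≡ (j == i)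
==-sym i j with i ≟ j | j ≟ i
... | yes _ | yes _ = refl
... | no _  | no _  = refl
... | yes p | no q  with q (sym p)
... | ()
==-sym i j | no p | yes q with p (sym q)
... | ()

==-refl : ∀ {n} (i : Fin n) → (i == i) ≡ true
==-refl i with i ≟ i
... | yes _ = refl
... | no p with p refl
... | ()

symClose : ∀ {n} → (Fin n → Fin n → Bool) → Fin n → Fin n → Bool
symClose f i j = not (i == j) ∧ (f i j ∨ f j i)

symClose-sym : ∀ {n} (f : Fin n → Fin n → Bool) i j → symClose f i j ≡ symClose f j i
symClose-sym f i j = cong₂ _∧_ (cong not (==-sym i j)) (∨-comm (f i j) (f j i))

symClose-irr : ∀ {n} (f : Fin n → Fin n → Bool) i → symClose f i i ≡ false
symClose-irr f i rewrite ==-refl i = refl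

complement : Graph → Graph
complement G = record
  { n      = n G
  ; adj    = λ i j → not (i == j) ∧ not (adj G i j)
  ; adj-sym = λ i j → cong₂ _∧_ (cong not (==-sym i j)) (cong not (Graph.adj-sym G i j))
  ; irrefl = λ i → irr i
  }
  where
  irr : ∀ i → (not (i == i) ∧ not (adj G i i)) ≡ false
  irr i rewrite ==-refl i = refl

induced : (G : Graph) {m : ℕ} → (Fin m ↣ Fin (n G)) → Graph
induced G {m} f = record
  { n      = m
  ; adj    = λ i j → adj G (Injection.to f i) (Injection.to f j)
  ; adj-sym = λ i j → Graph.adj-sym G _ _
  ; irrefl = λ i → irrefl G _
  }

deleteVertex : ∀ {m} (adjG : Fin (suc m) → Fin (suc m) → Bool) →
               (∀ i j → adjG i j ≡ adjG j i) → (∀ i → adjG i i ≡ false) →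
               Fin (suc m) → Graph
deleteVertex {m} adjG s r v = record
  { n      = m
  ; adj    = λ i j → adjG (punchIn v i) (punchIn v j)
  ; adj-sym = λ i j → s _ _
  ; irrefl = λ i → r _
  }

-- G / uv : the vertex v is merged into u (and removed); the merged vertex
-- is adjacent to every neighbour of u or of v; parallel edges and loops
-- are removed.
contractVertex : ∀ {m} (adjG : Fin (suc m) → Fin (suc m) → Bool) →
                 Fin (suc m) → Fin (suc m) → Graph
contractVertex {m} adjG u v = record
  { n      = m
  ; adj    = symClose f
  ; adj-sym = symClose-sym f
  ; irrefl = symClose-irr f
  }
  where
  f : Fin m → Fin m → Bool
  f i j = adjG (punchIn v i) (punchIn v j)
          ∨ ((punchIn v i == u) ∧ adjG v (punchIn v j))

delete : (G : Graph) → Fin (n G) → Graph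
delete record { n = suc m ; adj = a ; adj-sym = s ; irrefl = r } v = deleteVertex a s r v

contract : (G : Graph) (u v : Fin (n G)) → u ≢ v → adj G u v ≡ true → Graph
contract record { n = suc m ; adj = a ; adj-sym = s ; irrefl = r } u v _ _ = contractVertex a u v

data Step (G : Graph) : Graph → Set where
  del : (v : Fin (n G)) → Step G (delete G v)
  con : (u v : Fin (n G)) (u≢v : u ≢ v) (e : adj G u v ≡ true) →
        Step G (contract G u v u≢v e)

data Steps (G : Graph) : Graph → Set where
  done : Steps G G
  _∷_  : ∀ {G′ H} → Step G G′ → Steps G′ H → Steps G H

ProperInducedMinor : Graph → Graph → Set
ProperInducedMinor H G = Σ Graph λ G′ → Step G G′ × Steps G′ H

data Walk (G : Graph) : Fin (n G) → Fin (n G) → Set where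
  here : ∀ {u} → Walk G u u
  step : ∀ {u v w} → adj G u v ≡ true → Walk G v w → Walk G u w

Connected : Graph → Set
Connected G = ∀ u v → Walk G u v

TwoConnected : Graph → Set
TwoConnected G = (3 ≤ n G) × Connected G × (∀ v → Connected (delete G v))

Is2Cograph : Graph → Set
Is2Cograph G = ∀ {m} (f : Fin m ↣ Fin (n G)) →
  ¬ (TwoConnected (induced G f) × TwoConnected (complement (induced G f)))

InducedMinorMinimalNon2Cograph : Graph → Set
InducedMinorMinimalNon2Cograph G =
  ¬ Is2Cograph G × (∀ H → ProperInducedMinor H G → Is2Cograph H)

cycle : ℕ → Graph
cycle n = record
  { n      = n
  ; adj    = symClose f
  ; adj-sym = symClose-sym f
  ; irrefl = symClose-irr f
  }
  where
  f : Fin n → Fin n → Bool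
  f i j = ⌊ toℕ j ℕ.≟ suc (toℕ i) ⌋
          ∨ (⌊ toℕ i ℕ.≟ n ∸ 1 ⌋ ∧ ⌊ toℕ j ℕ.≟ 0 ⌋)

-- The complement of a proper induced minor H of co-C_n embeds, as a not necessarily
-- induced subgraph, into C_n with some vertex q missed: complementation turns a vertex
-- deletion into an induced embedding and a contraction G / uv into an embedding of
-- co-(G / uv) into co-G that sends the merged vertex to v. So the complement of every
-- induced subgraph of H lives inside the path C_n − q, where each vertex has at most one
-- neighbour further from q; a 2-connected graph, in which every vertex has two
-- neighbours, would give an infinite descent. Conversely co-C_n (for n ≥ 5) and C_n are
-- 2-connected, because each vertex v has a hub reachable from all other vertices
-- without passing through v.

module Submission where

open import Defs
open import Data.Bool using (Bool; true; false; not; _∧_; _∨_)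
open import Data.Bool.Properties
  using (∧-conicalˡ; ∧-conicalʳ; ∧-zeroʳ; ∨-conicalˡ; ∨-conicalʳ; ∨-zeroʳ; not-injective; ¬-not)
open import Data.Empty using (⊥-elim)
open import Data.Fin using (Fin; toℕ; fromℕ<; #_; punchIn; punchOut) renaming (zero to fzero)
open import Data.Fin.Properties
  using (_≟_; toℕ-injective; toℕ<n; toℕ-fromℕ<; punchIn-injective; punchInᵢ≢i; punchIn-punchOut)
open import Data.Nat using (ℕ; zero; suc; _+_; _∸_; _≤_; _<_; z≤n; s≤s; NonZero)
import Data.Nat as ℕ
open import Data.Nat.DivMod
  using (_%_; _mod_; %-distribˡ-+; m%n%n≡m%n; %-remove-+ˡ; m<n⇒m%n≡m; n%n≡0; m%n<n)
open import Data.Nat.Divisibility using (∣-refl)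
open import Data.Nat.Induction using (<-wellFounded)
open import Data.Nat.Properties
  using (+-assoc; +-suc; m∸n+n≡m; m∸n≤m; <⇒≤; m≤n⇒m<n∨m≡n; suc-injective; n<1+n; <-trans;
         ≤-reflexive; ≤-trans; ≤-pred; m≤n+m; 1+n≢n)
open import Data.Product using (Σ; ∃; ∃₂; _×_; _,_; proj₁; proj₂)
open import Data.Sum using (_⊎_; inj₁; inj₂; [_,_]′)
open import Function using (id; _∘_; _on_)
open import Function.Bundles using (Injection)
open import Function.Construct.Identity using (↣-id)
open import Induction.InfiniteDescent using (descent∧wf⇒empty)
open import Relation.Binary.Construct.Closure.ReflexiveTransitive
  using (Star; ε; _◅_; _◅◅_; fold; reverse)
import Relation.Binary.Construct.On as On
open import Relation.Binary.PropositionalEquality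
  using (_≡_; _≢_; refl; sym; trans; cong; cong₂; subst; module ≡-Reasoning)
open import Relation.Nullary using (¬_; Dec; yes; no)
open import Relation.Nullary.Decidable using (⌊_⌋; isYes≗does; dec-true; dec-false)
open import Relation.Unary using (U)

⌊⌋-true : ∀ {p} {P : Set p} (p? : Dec P) → P → ⌊ p? ⌋ ≡ true
⌊⌋-true p? p = trans (isYes≗does p?) (dec-true p? p)

⌊⌋-false : ∀ {p} {P : Set p} (p? : Dec P) → ¬ P → ⌊ p? ⌋ ≡ false
⌊⌋-false p? ¬p = trans (isYes≗does p?) (dec-false p? ¬p)

≢⇒==-false : ∀ {k} {i j : Fin k} → i ≢ j → (i == j) ≡ false
≢⇒==-false {i = i} {j} = ⌊⌋-false (i ≟ j)

==-false⇒≢ : ∀ {k} {i j : Fin k} → (i == j) ≡ false → i ≢ j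
==-false⇒≢ {i = i} e refl with () ← trans (sym (==-refl i)) e

∨-true : ∀ {a b} → a ∨ b ≡ true → a ≡ true ⊎ b ≡ true
∨-true {true}  _ = inj₁ refl
∨-true {false} e = inj₂ e

complement-adj⁺ : (G : Graph) {i j : Fin (n G)} → i ≢ j → adj G i j ≡ false →
                  adj (complement G) i j ≡ true
complement-adj⁺ G i≢j e rewrite ≢⇒==-false i≢j | e = refl

complement-adj⁻ : (G : Graph) {i j : Fin (n G)} → adj (complement G) i j ≡ true →
                  i ≢ j × adj G i j ≡ false
complement-adj⁻ G {i} {j} e =
  ==-false⇒≢ (not-injective (∧-conicalˡ _ _ e)) , not-injective (∧-conicalʳ (not (i == j)) _ e)

complement-adj-false : (G : Graph) {i j : Fin (n G)} → adj G i j ≡ true →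
                       adj (complement G) i j ≡ false
complement-adj-false G e rewrite e = ∧-zeroʳ _

record Embedding (H G : Graph) : Set where
  field
    to        : Fin (n H) → Fin (n G)
    injective : ∀ {i j} → to i ≡ to j → i ≡ j
    adj-pres  : ∀ {i j} → adj H i j ≡ true → adj G (to i) (to j) ≡ true

open Embedding

EmbeddingAvoiding : (H G : Graph) → Fin (n G) → Set
EmbeddingAvoiding H G q = Σ (Embedding H G) λ e → ∀ i → to e i ≢ q

id-embedding : ∀ {G} → Embedding G G
id-embedding = record { to = id ; injective = id ; adj-pres = id }

_⨾_ : ∀ {K H G} → Embedding K H → Embedding H G → Embedding K G
e ⨾ f = record
  { to        = to f ∘ to e
  ; injective = injective e ∘ injective f
  ; adj-pres  = adj-pres f ∘ adj-pres e
  }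

complement²-embedding : (G : Graph) → Embedding (complement (complement G)) G
complement²-embedding G = record { to = id ; injective = id ; adj-pres = adj-pres′ }
  where
  adj-pres′ : ∀ {i j} → adj (complement (complement G)) i j ≡ true → adj G i j ≡ true
  adj-pres′ {i} {j} e with i≢j , e′ ← complement-adj⁻ (complement G) {i} {j} e =
    not-injective (trans (sym (cong (λ b → not b ∧ not (adj G i j)) (≢⇒==-false i≢j))) e′)

induced-complement-embedding : ∀ {H G} (g : Fin (n H) → Fin (n G)) → (∀ {i j} → g i ≡ g j → i ≡ j) →
  (∀ i j → adj H i j ≡ adj G (g i) (g j)) → Embedding (complement H) (complement G)
induced-complement-embedding {H} {G} g g-injective adj≡ = record
  { to        = g
  ; injective = g-injective
  ; adj-pres  = λ e → let i≢j , e′ = complement-adj⁻ H e in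
      complement-adj⁺ G (i≢j ∘ g-injective) (trans (sym (adj≡ _ _)) e′)
  }

-- Complements of induced minors

module _ {m} (a : Fin (suc m) → Fin (suc m) → Bool) (a-sym : ∀ i j → a i j ≡ a j i)
         (a-irrefl : ∀ i → a i i ≡ false) (u v : Fin (suc m)) where

  -- The merged vertex of G / uv is sent to v rather than u: its complement-neighbours
  -- are complement-neighbours of both u and v, and this keeps u out of the image.
  representative : Fin m → Fin (suc m)
  representative i with punchIn v i ≟ u
  ... | yes _ = v
  ... | no  _ = punchIn v i

  representative-injective : u ≢ v → ∀ {i j} → representative i ≡ representative j → i ≡ j
  representative-injective u≢v {i} {j} e with punchIn v i ≟ u | punchIn v j ≟ u
  ... | yes i↦u | yes j↦u = punchIn-injective v i j (trans i↦u (sym j↦u))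
  ... | yes _   | no  _   = ⊥-elim (punchInᵢ≢i v j (sym e))
  ... | no  _   | yes _   = ⊥-elim (punchInᵢ≢i v i e)
  ... | no  _   | no  _   = punchIn-injective v i j e

  representative≢u : u ≢ v → ∀ i → representative i ≢ u
  representative≢u u≢v i with punchIn v i ≟ u
  ... | yes _   = u≢v ∘ sym
  ... | no  i≢u = i≢u

  private
    G : Graph
    G = record { n = suc m ; adj = a ; adj-sym = a-sym ; irrefl = a-irrefl }

    mergedArc : Fin m → Fin m → Bool
    mergedArc i j = a (punchIn v i) (punchIn v j) ∨ ((punchIn v i == u) ∧ a v (punchIn v j))

  contraction-complement-embedding : u ≢ v →
    EmbeddingAvoiding (complement (contractVertex a u v)) (complement G) u
  contraction-complement-embedding u≢v = embedding , representative≢u u≢v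
    where
    nonadjacent : ∀ {i j} → i ≢ j → mergedArc i j ≡ false → mergedArc j i ≡ false →
                  a (representative i) (representative j) ≡ false
    nonadjacent {i} {j} i≢j ij ji with punchIn v i ≟ u | punchIn v j ≟ u
    ... | yes i↦u | yes j↦u = ⊥-elim (i≢j (punchIn-injective v i j (trans i↦u (sym j↦u))))
    ... | yes _   | no  _   = ∨-conicalʳ _ _ ij
    ... | no  _   | yes _   = trans (a-sym _ _) (∨-conicalʳ _ _ ji)
    ... | no  _   | no  _   = ∨-conicalˡ _ _ ij

    embedding : Embedding (complement (contractVertex a u v)) (complement G)
    embedding = record
      { to        = representative
      ; injective = representative-injective u≢v
      ; adj-pres  = λ {i} {j} e →
          let i≢j , e′ = complement-adj⁻ (contractVertex a u v) {i} {j} e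
              arcs = trans (sym (cong (λ b → not b ∧ (mergedArc i j ∨ mergedArc j i)) (≢⇒==-false i≢j))) e′
          in complement-adj⁺ G (i≢j ∘ representative-injective u≢v)
               (nonadjacent i≢j (∨-conicalˡ (mergedArc i j) _ arcs)
                                (∨-conicalʳ (mergedArc i j) (mergedArc j i) arcs))
      }

step-complement-embedding : ∀ {G G′} → Step G G′ → ∃ (EmbeddingAvoiding (complement G′) (complement G))
step-complement-embedding {record { n = zero }} (del ())
step-complement-embedding {record { n = suc _ }} (del v) =
  v , induced-complement-embedding (punchIn v) (punchIn-injective v _ _) (λ _ _ → refl) , punchInᵢ≢i v
step-complement-embedding {record { n = zero }} (con () _ _ _)
step-complement-embedding {record { n = suc _ ; adj = a ; adj-sym = s ; irrefl = r }} (con u v u≢v _) =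
  u , contraction-complement-embedding a s r u v u≢v

steps-complement-embedding : ∀ {G G′} → Steps G G′ → Embedding (complement G′) (complement G)
steps-complement-embedding done       = id-embedding
steps-complement-embedding (st ∷ sts) =
  steps-complement-embedding sts ⨾ proj₁ (proj₂ (step-complement-embedding st))

proper-minor-complement-embedding : ∀ {H G} → ProperInducedMinor H G →
  ∃ (EmbeddingAvoiding (complement H) (complement G))
proper-minor-complement-embedding (_ , st , sts) with q , e , e≢q ← step-complement-embedding st =
  q , steps-complement-embedding sts ⨾ e , e≢q ∘ to (steps-complement-embedding sts)

-- 2-connectivity

-- The edges of G − v, with the vertices of G − v numbered as in G.
AdjAvoiding : (G : Graph) → Fin (n G) → Fin (n G) → Fin (n G) → Set
AdjAvoiding G v x y = x ≢ v × y ≢ v × adj G x y ≡ true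

HubAvoiding : (G : Graph) → Fin (n G) → Fin (n G) → Set
HubAvoiding G v h = h ≢ v × (∀ x → x ≢ v → Star (AdjAvoiding G v) x h)

adjAvoiding-sym : ∀ G v {x y} → AdjAvoiding G v x y → AdjAvoiding G v y x
adjAvoiding-sym G v (x≢v , y≢v , x~y) = y≢v , x≢v , trans (adj-sym G _ _) x~y

walk-of-avoiding : ∀ G v {x y} → Star (AdjAvoiding G v) x y → Walk G x y
walk-of-avoiding G v = fold (Walk G) (λ (_ , _ , x~y) → step x~y) here

walk-in-delete : ∀ {m} (a : Fin (suc m) → Fin (suc m) → Bool) s r v {x y p q} →
  Star (AdjAvoiding (record { n = suc m ; adj = a ; adj-sym = s ; irrefl = r }) v) p q →
  punchIn v x ≡ p → punchIn v y ≡ q → Walk (deleteVertex a s r v) x y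
walk-in-delete a s r v {x} {y} ε x↦p y↦p with refl ← punchIn-injective v x y (trans x↦p (sym y↦p)) = here
walk-in-delete a s r v {x} (_◅_ {j = w} (_ , w≢v , p~w) ws) refl y↦q =
  step (subst (λ t → a (punchIn v x) t ≡ true) (sym w↤) p~w) (walk-in-delete a s r v ws w↤ y↦q)
  where
  w↤ : punchIn v (punchOut (w≢v ∘ sym)) ≡ w
  w↤ = punchIn-punchOut (w≢v ∘ sym)

distinct-from-both : ∀ {k} (x y : Fin (suc (suc (suc k)))) → ∃ λ v → v ≢ x × v ≢ y
distinct-from-both x y with x ≟ y
... | yes refl = punchIn x fzero , punchInᵢ≢i x fzero , punchInᵢ≢i x fzero
... | no x≢y   = punchIn x (punchIn y′ fzero) , punchInᵢ≢i x _ ,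
  λ e → punchInᵢ≢i y′ fzero (punchIn-injective x _ _ (trans e (sym (punchIn-punchOut x≢y))))
  where y′ = punchOut x≢y

twoConnected-by-hubs : (G : Graph) → 3 ≤ n G → (∀ v → ∃ (HubAvoiding G v)) → TwoConnected G
twoConnected-by-hubs record { n = 0 } () _
twoConnected-by-hubs record { n = 1 } (s≤s ()) _
twoConnected-by-hubs record { n = 2 } (s≤s (s≤s ())) _
twoConnected-by-hubs G@record { n = suc (suc (suc _)) ; adj = a ; adj-sym = s ; irrefl = r } 3≤n hubs =
  3≤n , connected , λ v x y → walk-in-delete a s r v (avoiding v (punchInᵢ≢i v x) (punchInᵢ≢i v y)) refl refl
  where
  avoiding : ∀ v {x y} → x ≢ v → y ≢ v → Star (AdjAvoiding G v) x y
  avoiding v x≢v y≢v with _ , _ , to-hub ← hubs v =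
    to-hub _ x≢v ◅◅ reverse (adjAvoiding-sym G v) (to-hub _ y≢v)

  connected : Connected G
  connected x y with v , v≢x , v≢y ← distinct-from-both x y =
    walk-of-avoiding G v (avoiding v (v≢x ∘ sym) (v≢y ∘ sym))

first-neighbour : ∀ {G x y} → Walk G x y → x ≢ y → ∃ λ w → adj G x w ≡ true
first-neighbour here           x≢x = ⊥-elim (x≢x refl)
first-neighbour (step x~w _) _   = _ , x~w

two-neighbours : (K : Graph) → TwoConnected K →
                 ∀ x → ∃₂ λ y z → y ≢ z × adj K x y ≡ true × adj K x z ≡ true
two-neighbours record { n = 0 } _ ()
two-neighbours record { n = 1 } (s≤s () , _) _
two-neighbours record { n = 2 } (s≤s (s≤s ()) , _) _
two-neighbours record { n = suc (suc (suc _)) ; adj = a ; irrefl = r } (_ , connected , connected-minus) x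
  with y , x~y ← first-neighbour (connected x (punchIn x fzero)) (punchInᵢ≢i x fzero ∘ sym) =
  let x′ = punchOut y≢x
      w , x′~w = first-neighbour (connected-minus y x′ (punchIn x′ fzero)) (punchInᵢ≢i x′ fzero ∘ sym)
  in y , punchIn y w , punchInᵢ≢i y w ∘ sym , x~y ,
     subst (λ t → a t (punchIn y w) ≡ true) (punchIn-punchOut y≢x) x′~w
  where
  y≢x : y ≢ x
  y≢x refl with () ← trans (sym x~y) (r x)

no-descending-rank : ∀ {a} {A : Set a} (rank : A → ℕ) → (∀ x → ∃ λ y → rank y < rank x) → ¬ A
no-descending-rank rank descent x =
  descent∧wf⇒empty {_<_ = _<_ on rank} {P = U}
    (λ {x} _ → let y , y<x = descent x in y , y<x , _) (On.wellFounded rank <-wellFounded) x _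

-- The cycle

[k+m%n]%n≡[k+m]%n : ∀ k m n .{{_ : NonZero n}} → (k + m % n) % n ≡ (k + m) % n
[k+m%n]%n≡[k+m]%n k m n = begin
  (k + m % n) % n           ≡⟨ %-distribˡ-+ k (m % n) n ⟩
  (k % n + m % n % n) % n   ≡⟨ cong (λ t → (k % n + t) % n) (m%n%n≡m%n m n) ⟩
  (k % n + m % n) % n       ≡⟨ %-distribˡ-+ k m n ⟨
  (k + m) % n               ∎
  where open ≡-Reasoning

[c+a]%n≡[c+b]%n⇒a≡b : ∀ {a b} c n .{{_ : NonZero n}} → c ≤ n → a < n → b < n →
                      (c + a) % n ≡ (c + b) % n → a ≡ b
[c+a]%n≡[c+b]%n⇒a≡b c n c≤n a<n b<n e =
  trans (sym (undo a<n)) (trans (cong (λ t → (n ∸ c + t) % n) e) (undo b<n))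
  where
  undo : ∀ {x} → x < n → (n ∸ c + (c + x) % n) % n ≡ x
  undo {x} x<n = begin
    (n ∸ c + (c + x) % n) % n   ≡⟨ [k+m%n]%n≡[k+m]%n (n ∸ c) (c + x) n ⟩
    (n ∸ c + (c + x)) % n       ≡⟨ cong (_% n) (+-assoc (n ∸ c) c x) ⟨
    (n ∸ c + c + x) % n         ≡⟨ cong (λ t → (t + x) % n) (m∸n+n≡m c≤n) ⟩
    (n + x) % n                 ≡⟨ %-remove-+ˡ x ∣-refl ⟩
    x % n                       ≡⟨ m<n⇒m%n≡m x<n ⟩
    x                           ∎
    where open ≡-Reasoning

ρ : ∀ {m} → Fin (suc m) → Fin (suc m)
ρ {m} x = suc (toℕ x) mod suc m

toℕ-ρ : ∀ {m} (x : Fin (suc m)) → toℕ (ρ x) ≡ suc (toℕ x) % suc m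
toℕ-ρ x = toℕ-fromℕ< _

ρ-injective : ∀ {m} {x y : Fin (suc m)} → ρ x ≡ ρ y → x ≡ y
ρ-injective {m} {x} {y} e = toℕ-injective
  ([c+a]%n≡[c+b]%n⇒a≡b 1 (suc m) (s≤s z≤n) (toℕ<n x) (toℕ<n y)
    (trans (sym (toℕ-ρ x)) (trans (cong toℕ e) (toℕ-ρ y))))

ρ^ : ∀ {m} → ℕ → Fin (suc m) → Fin (suc m)
ρ^ zero    x = x
ρ^ (suc k) x = ρ (ρ^ k x)

-- the number of ρ-steps from q to y
offset : ∀ {m} → Fin (suc m) → Fin (suc m) → ℕ
offset {m} q y = (suc m ∸ toℕ q + toℕ y) % suc m

offset<n : ∀ {m} (q y : Fin (suc m)) → offset q y < suc m
offset<n {m} q y = m%n<n (suc m ∸ toℕ q + toℕ y) (suc m)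

offset-self : ∀ {m} (q : Fin (suc m)) → offset q q ≡ 0
offset-self {m} q = trans (cong (_% suc m) (m∸n+n≡m (<⇒≤ (toℕ<n q)))) (n%n≡0 (suc m))

offset-injective : ∀ {m} (q : Fin (suc m)) {y z} → offset q y ≡ offset q z → y ≡ z
offset-injective {m} q {y} {z} =
  toℕ-injective ∘ [c+a]%n≡[c+b]%n⇒a≡b (suc m ∸ toℕ q) (suc m) (m∸n≤m (suc m) (toℕ q)) (toℕ<n y) (toℕ<n z)

offset≡0⇒≡ : ∀ {m} (q : Fin (suc m)) {y} → offset q y ≡ 0 → y ≡ q
offset≡0⇒≡ q e = offset-injective q (trans e (sym (offset-self q)))

offset-ρ : ∀ {m} (q y : Fin (suc m)) → offset q (ρ y) ≡ suc (offset q y) % suc m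
offset-ρ {m} q y = begin
  (c + toℕ (ρ y)) % suc m            ≡⟨ cong (λ t → (c + t) % suc m) (toℕ-ρ y) ⟩
  (c + suc (toℕ y) % suc m) % suc m  ≡⟨ [k+m%n]%n≡[k+m]%n c (suc (toℕ y)) (suc m) ⟩
  (c + suc (toℕ y)) % suc m          ≡⟨ cong (_% suc m) (+-suc c (toℕ y)) ⟩
  suc (c + toℕ y) % suc m            ≡⟨ [k+m%n]%n≡[k+m]%n 1 (c + toℕ y) (suc m) ⟨
  suc (offset q y) % suc m           ∎
  where
  open ≡-Reasoning
  c = suc m ∸ toℕ q

offset-ρ-≢ : ∀ {m} (q y : Fin (suc m)) → ρ y ≢ q → offset q (ρ y) ≡ suc (offset q y)
offset-ρ-≢ {m} q y ρy≢q with m≤n⇒m<n∨m≡n (offset<n q y)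
... | inj₁ 1+o<n = trans (offset-ρ q y) (m<n⇒m%n≡m 1+o<n)
... | inj₂ 1+o≡n = ⊥-elim (ρy≢q (offset≡0⇒≡ q
        (trans (offset-ρ q y) (trans (cong (_% suc m) 1+o≡n) (n%n≡0 (suc m))))))

offset-ρ^ : ∀ {m} (v : Fin (suc m)) k → k < suc m → offset v (ρ^ k v) ≡ k
offset-ρ^ v zero    _   = offset-self v
offset-ρ^ {m} v (suc k) k<n = begin
  offset v (ρ (ρ^ k v))            ≡⟨ offset-ρ v (ρ^ k v) ⟩
  suc (offset v (ρ^ k v)) % suc m  ≡⟨ cong (λ t → suc t % suc m) (offset-ρ^ v k (<-trans (n<1+n k) k<n)) ⟩
  suc k % suc m                    ≡⟨ m<n⇒m%n≡m k<n ⟩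
  suc k                            ∎
  where open ≡-Reasoning

-- Definitionally the relation whose symmetric closure is `cycle (suc m)`.
cycleArc : ∀ {m} → Fin (suc m) → Fin (suc m) → Bool
cycleArc {m} i j = ⌊ toℕ j ℕ.≟ suc (toℕ i) ⌋ ∨ (⌊ toℕ i ℕ.≟ m ⌋ ∧ ⌊ toℕ j ℕ.≟ 0 ⌋)

cycleArc⇒ρ : ∀ {m} (i j : Fin (suc m)) → cycleArc i j ≡ true → j ≡ ρ i
cycleArc⇒ρ {m} i j e with toℕ j ℕ.≟ suc (toℕ i) | toℕ i ℕ.≟ m | toℕ j ℕ.≟ 0
... | yes j≡1+i | _ | _ = toℕ-injective (trans j≡1+i (sym
        (trans (toℕ-ρ i) (m<n⇒m%n≡m (subst (_< suc m) j≡1+i (toℕ<n j))))))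
... | no _ | yes i≡m | yes j≡0 = toℕ-injective (trans j≡0 (sym
        (trans (toℕ-ρ i) (trans (cong (λ t → suc t % suc m) i≡m) (n%n≡0 (suc m))))))
cycleArc⇒ρ i j () | no _ | yes _ | no _
cycleArc⇒ρ i j () | no _ | no _  | _

ρ-cycleArc : ∀ {m} (i : Fin (suc m)) → cycleArc i (ρ i) ≡ true
ρ-cycleArc {m} i with m≤n⇒m<n∨m≡n (toℕ<n i)
... | inj₁ 1+i<n = cong (_∨ (⌊ toℕ i ℕ.≟ m ⌋ ∧ ⌊ toℕ (ρ i) ℕ.≟ 0 ⌋))
        (⌊⌋-true (toℕ (ρ i) ℕ.≟ suc (toℕ i)) (trans (toℕ-ρ i) (m<n⇒m%n≡m 1+i<n)))
... | inj₂ 1+i≡n = trans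
        (cong₂ (λ b c → ⌊ toℕ (ρ i) ℕ.≟ suc (toℕ i) ⌋ ∨ (b ∧ c))
          (⌊⌋-true (toℕ i ℕ.≟ m) (suc-injective 1+i≡n))
          (⌊⌋-true (toℕ (ρ i) ℕ.≟ 0) (trans (toℕ-ρ i) (trans (cong (_% suc m) 1+i≡n) (n%n≡0 (suc m))))))
        (∨-zeroʳ _)

cycle-adj⇒ : ∀ {m} {x y : Fin (suc m)} → adj (cycle (suc m)) x y ≡ true → y ≡ ρ x ⊎ x ≡ ρ y
cycle-adj⇒ {x = x} {y} e with ∨-true (∧-conicalʳ (not (x == y)) _ e)
... | inj₁ x→y = inj₁ (cycleArc⇒ρ x y x→y)
... | inj₂ y→x = inj₂ (cycleArc⇒ρ y x y→x)

cycle-adj-ρ : ∀ {m} {x : Fin (suc m)} → x ≢ ρ x → adj (cycle (suc m)) x (ρ x) ≡ true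
cycle-adj-ρ {x = x} x≢ρx rewrite ≢⇒==-false x≢ρx | ρ-cycleArc x = refl

cycle-lower-neighbour : ∀ {m} {q p w : Fin (suc m)} → p ≢ q → adj (cycle (suc m)) p w ≡ true →
                        w ≢ ρ p → offset q w < offset q p
cycle-lower-neighbour {q = q} {w = w} p≢q p~w w≢ρp with cycle-adj⇒ p~w
... | inj₁ w≡ρp = ⊥-elim (w≢ρp w≡ρp)
... | inj₂ refl = ≤-reflexive (sym (offset-ρ-≢ q w p≢q))

twoConnected-not-in-path : ∀ {m} (K : Graph) (q : Fin (suc m)) → TwoConnected K →
                           ¬ EmbeddingAvoiding K (cycle (suc m)) q
twoConnected-not-in-path K q tc@(3≤n , _) (e , e≢q) =
  no-descending-rank (offset q ∘ to e) descent (fromℕ< (≤-trans (s≤s z≤n) 3≤n))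
  where
  descent : ∀ x → ∃ λ y → offset q (to e y) < offset q (to e x)
  descent x with y , z , y≢z , x~y , x~z ← two-neighbours K tc x | to e y ≟ ρ (to e x)
  ... | no  y≢ρx = y , cycle-lower-neighbour (e≢q x) (adj-pres e x~y) y≢ρx
  ... | yes y≡ρx = z , cycle-lower-neighbour (e≢q x) (adj-pres e x~z)
                         (λ z≡ρx → y≢z (injective e (trans y≡ρx (sym z≡ρx))))

2cograph-if-complement-in-path : ∀ {m} (H : Graph) (q : Fin (suc m)) →
  EmbeddingAvoiding (complement H) (cycle (suc m)) q → Is2Cograph H
2cograph-if-complement-in-path H q (e , e≢q) f (_ , tc) =
  twoConnected-not-in-path _ q tc (f-embedding ⨾ e , e≢q ∘ Injection.to f)
  where
  f-embedding : Embedding (complement (induced H f)) (complement H)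
  f-embedding = induced-complement-embedding (Injection.to f) (Injection.injective f) (λ _ _ → refl)

proper-minor-of-complement-cycle-2cograph : ∀ {m} H → ProperInducedMinor H (complement (cycle (suc m))) →
                                            Is2Cograph H
proper-minor-of-complement-cycle-2cograph {m} H minor
  with q , e , e≢q ← proper-minor-complement-embedding minor =
  2cograph-if-complement-in-path H q (e ⨾ complement²-embedding (cycle (suc m)) , e≢q)

complement²-cycle-adj-ρ : ∀ {m} {x : Fin (suc m)} → x ≢ ρ x →
                          adj (complement (complement (cycle (suc m)))) x (ρ x) ≡ true
complement²-cycle-adj-ρ {m} {x} x≢ρx =
  complement-adj⁺ (complement (cycle (suc m))) x≢ρx
    (complement-adj-false (cycle (suc m)) {x} {ρ x} (cycle-adj-ρ x≢ρx))

complement²-cycle-twoConnected : ∀ {m} → 3 ≤ suc m → TwoConnected (complement (complement (cycle (suc m))))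
complement²-cycle-twoConnected {m} 3≤n@(s≤s (s≤s _)) = twoConnected-by-hubs C 3≤n hub
  where
  C = complement (complement (cycle (suc m)))

  -- The hub is the predecessor ρ^ m v of v, reached by walking forward along the cycle.
  hub : ∀ v → ∃ (HubAvoiding C v)
  hub v = ρ^ m v , t≢v , λ x x≢v → along (m ∸ offset v x) x x≢v (m∸n+n≡m (≤-pred (offset<n v x)))
    where
    offset-t : offset v (ρ^ m v) ≡ m
    offset-t = offset-ρ^ v m (n<1+n m)

    t≢v : ρ^ m v ≢ v
    t≢v t≡v with () ← trans (sym offset-t) (trans (cong (offset v) t≡v) (offset-self v))

    along : ∀ k x → x ≢ v → k + offset v x ≡ m → Star (AdjAvoiding C v) x (ρ^ m v)
    along zero    x _   o≡m   = subst (Star _ x) (offset-injective v (trans o≡m (sym offset-t))) ε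
    along (suc k) x x≢v k+o≡m =
      (x≢v , ρx≢v , complement²-cycle-adj-ρ x≢ρx) ◅
      along k (ρ x) ρx≢v (trans (cong (k +_) ρx↦1+o) (trans (+-suc k o) k+o≡m))
      where
      o = offset v x
      ρx↦1+o : offset v (ρ x) ≡ suc o
      ρx↦1+o = trans (offset-ρ v x) (m<n⇒m%n≡m (s≤s (subst (suc o ≤_) k+o≡m (s≤s (m≤n+m o k)))))
      ρx≢v : ρ x ≢ v
      ρx≢v ρx≡v with () ← trans (sym ρx↦1+o) (trans (cong (offset v) ρx≡v) (offset-self v))
      x≢ρx : x ≢ ρ x
      x≢ρx x≡ρx = 1+n≢n (sym (trans (cong (offset v) x≡ρx) ρx↦1+o))

complement-cycle-adj : ∀ {m} {x y : Fin (suc m)} → x ≢ y → y ≢ ρ x → x ≢ ρ y →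
                       adj (complement (cycle (suc m))) x y ≡ true
complement-cycle-adj {m} x≢y y≢ρx x≢ρy =
  complement-adj⁺ (cycle (suc m)) x≢y (¬-not λ x~y → [ y≢ρx , x≢ρy ]′ (cycle-adj⇒ x~y))

complement-cycle-twoConnected : ∀ {m} → 5 ≤ suc m → TwoConnected (complement (cycle (suc m)))
complement-cycle-twoConnected {m} 5≤n = twoConnected-by-hubs C̄ (≤-trans (s≤s (s≤s (s≤s z≤n))) 5≤n) hub
  where
  C̄ = complement (cycle (suc m))

  -- The hub is ρ v. Of the vertices other than v, only ρ² v is not adjacent to it, and
  -- ρ² v reaches it through ρ⁴ v; n ≥ 5 keeps v, …, ρ⁴ v distinct.
  hub : ∀ v → ∃ (HubAvoiding C̄ v)
  hub v = p (# 1) , distinct (# 1) (# 0) (λ ()) , to-hub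
    where
    p : Fin 5 → Fin (suc m)
    p i = ρ^ (toℕ i) v

    distinct : ∀ i j → i ≢ j → p i ≢ p j
    distinct i j i≢j pi≡pj =
      i≢j (toℕ-injective (trans (sym (offset-p i)) (trans (cong (offset v) pi≡pj) (offset-p j))))
      where
      offset-p : ∀ i → offset v (p i) ≡ toℕ i
      offset-p i = offset-ρ^ v (toℕ i) (≤-trans (toℕ<n i) 5≤n)

    edge : ∀ {x y} → x ≢ v → y ≢ v → x ≢ y → y ≢ ρ x → x ≢ ρ y → AdjAvoiding C̄ v x y
    edge x≢v y≢v x≢y y≢ρx x≢ρy = x≢v , y≢v , complement-cycle-adj x≢y y≢ρx x≢ρy

    to-hub : ∀ x → x ≢ v → Star (AdjAvoiding C̄ v) x (p (# 1))
    to-hub x x≢v with x ≟ p (# 1) | x ≟ p (# 2)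
    ... | yes refl | _        = ε
    ... | no  _    | yes refl =
      edge (distinct (# 2) (# 0) (λ ())) (distinct (# 4) (# 0) (λ ())) (distinct (# 2) (# 4) (λ ()))
           (distinct (# 4) (# 3) (λ ())) (distinct (# 1) (# 4) (λ ()) ∘ ρ-injective) ◅
      edge (distinct (# 4) (# 0) (λ ())) (distinct (# 1) (# 0) (λ ())) (distinct (# 4) (# 1) (λ ()))
           (distinct (# 0) (# 4) (λ ()) ∘ ρ-injective) (distinct (# 4) (# 2) (λ ())) ◅ ε
    ... | no x≢p1  | no x≢p2  =
      edge x≢v (distinct (# 1) (# 0) (λ ())) x≢p1 (x≢v ∘ sym ∘ ρ-injective) x≢p2 ◅ ε

lemma3p2 : (n : ℕ) → 5 ≤ n → InducedMinorMinimalNon2Cograph (complement (cycle n))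
lemma3p2 (suc m) 5≤n = not-2cograph , proper-minor-of-complement-cycle-2cograph
  where
  -- `induced G` along the identity injection is definitionally G.
  not-2cograph : ¬ Is2Cograph (complement (cycle (suc m)))
  not-2cograph is2cograph = is2cograph (↣-id _)
    ( complement-cycle-twoConnected 5≤n
    , complement²-cycle-twoConnected (≤-trans (s≤s (s≤s (s≤s z≤n))) 5≤n))
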